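{- Let $G$ be a finite simple graph and let $T$ be a double-star of order $m$. If there is an edge $e=uv\in E(G)$ such that $|N(u)\setminus \{v\}|\geq \lfloor \frac{m}{2}\rfloor-1$, $|N(v)\setminus \{u\}|\geq m-3$ and $|(N(u)\cup N(v))\setminus \{u,v\}|\geq m-2$, then $G$ contains a subgraph $T'$ isomorphic to $T$.
   Context: Graphs are finite, undirected, without loops or multiple edges. $N(x)$ denotes the set of neighbors of a vertex $x$ in $G$. A tree is a connected graph without cycles; a double-star is a tree having exactly two vertices of degree greater than one. The order of a graph is its number of vertices. -}

module Defs where

open import Data.Nat using (ℕ; zero; suc; _≤_; _<_; _∸_; _/_)
open import Data.Bool using (Bool; true; false; _∧_; _∨_; not)
open import Data.Fin using (Fin; _≟_)
open import Data.List using (List; []; _∷_; length; filter; allFin)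
open import Data.List.Relation.Unary.Unique.Propositional using (Unique)
open import Data.Product using (Σ; ∃; ∃-syntax; _×_; _,_)
open import Data.Sum using (_⊎_)
open import Relation.Nullary using (¬_; Dec; yes; no)
open import Relation.Nullary.Decidable using (⌊_⌋)
open import Relation.Binary.PropositionalEquality using (_≡_; _≢_)
open import Function.Definitions using (Injective)

record Graph (n : ℕ) : Set where
  field
    adj    : Fin n → Fin n → Bool
    sym    : ∀ x y → adj x y ≡ adj y x
    irrefl : ∀ x → adj x x ≡ false
open Graph public

countV : {n : ℕ} → (Fin n → Bool) → ℕ
countV {n} p = length (filter (λ w → p w Data.Bool.≟ true) (allFin n))

deg : {n : ℕ} → Graph n → Fin n → ℕ
deg G x = countV (adj G x)

nbrMinus : {n : ℕ} → Graph n → Fin n → Fin n → ℕ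
nbrMinus G u v = countV (λ w → adj G u w ∧ not ⌊ w ≟ v ⌋)

unionNbrMinus : {n : ℕ} → Graph n → Fin n → Fin n → ℕ
unionNbrMinus G u v =
  countV (λ w → (adj G u w ∨ adj G v w) ∧ not ⌊ w ≟ u ⌋ ∧ not ⌊ w ≟ v ⌋)

data Walk {n : ℕ} (G : Graph n) : Fin n → Fin n → Set where
  here : ∀ {x} → Walk G x x
  step : ∀ {x y z} → adj G x y ≡ true → Walk G y z → Walk G x z

Connected : {n : ℕ} → Graph n → Set
Connected G = ∀ x y → Walk G x y

PathList : {n : ℕ} → Graph n → Fin n → List (Fin n) → Set
PathList G x [] = Data.Unit.⊤ where import Data.Unit
PathList G x (y ∷ ys) = adj G x y ≡ true × PathList G y ys

lastOf : {n : ℕ} → Fin n → List (Fin n) → Fin n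
lastOf x [] = x
lastOf x (y ∷ ys) = lastOf y ys

HasCycle : {n : ℕ} → Graph n → Set
HasCycle G = Σ _ λ x → Σ (List _) λ xs →
  (2 ≤ length xs) × Unique (x ∷ xs) × PathList G x xs × (adj G (lastOf x xs) x ≡ true)

IsTree : {n : ℕ} → Graph n → Set
IsTree G = Connected G × ¬ HasCycle G

IsDoubleStar : {m : ℕ} → Graph m → Set
IsDoubleStar {m} T = IsTree T ×
  (countV (λ x → ⌊ 2 Data.Nat.≤? deg T x ⌋) ≡ 2)

-- G contains a subgraph isomorphic to T: an injective vertex map preserving edges
-- (its image together with the image edges is a subgraph T' ≅ T).
ContainsCopy : {n m : ℕ} → Graph n → Graph m → Set
ContainsCopy {n} {m} G T = Σ (Fin m → Fin n) λ f →
  Injective _≡_ _≡_ f × (∀ a b → adj T a b ≡ true → adj G (f a) (f b) ≡ true)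

module Submission where

-- A double star T consists of adjacent centres x, y with p ≥ 1 leaves at x and q ≥ 1
-- leaves at y, and p + q ≤ m − 2; swapping the centres we may assume p ≤ q, so the
-- hypotheses give p ≤ |N(u)∖{v}|, q ≤ |N(v)∖{u}| and p + q ≤ |(N(u) ∪ N(v))∖{u,v}|.
-- These are Hall's conditions for two sets: listing N(u)∖N(v), then N(u) ∩ N(v), then
-- N(v)∖N(u) (all without u, v), the first p entries lie in N(u) and the last q in N(v),
-- and they do not overlap. Sending x ↦ u, y ↦ v and the leaves of x and of y injectively
-- into these two blocks embeds T in G.

open import Defs hiding (sym)
open import Data.Bool as Bool using (Bool; true; false; _∧_; _∨_; not)
open import Data.Empty using (⊥-elim)
open import Data.Fin using (Fin; zero; suc; _≟_; inject≤)
open import Data.Fin.Properties using (injective⇒≤; inject≤-injective)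
open import Data.List using (List; []; _∷_; _++_; length; filter; allFin; take; drop; lookup)
open import Data.List.Properties using (length-take; length-drop; length-++; ++-assoc; length-tabulate)
open import Data.List.Membership.Propositional using (_∈_; _∉_)
open import Data.List.Membership.Propositional.Properties
  using (∈-lookup; ∈-filter⁺; ∈-filter⁻; ∈-allFin; ∈-++⁺ˡ; ∈-++⁺ʳ; ∈-++⁻)
open import Data.List.Membership.Setoid.Properties using (index-injective)
open import Data.List.Relation.Binary.Disjoint.Propositional using (Disjoint)
open import Data.List.Relation.Binary.Subset.Propositional using (_⊆_)
open import Data.List.Relation.Unary.All as All using ([]; _∷_)
open import Data.List.Relation.Unary.AllPairs using ([]; _∷_)
open import Data.List.Relation.Unary.Any using (here; there; index)
open import Data.List.Relation.Unary.Unique.Propositional using (Unique)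
open import Data.List.Relation.Unary.Unique.Propositional.Properties
  using (take⁺; drop⁺; filter⁺; allFin⁺; ++⁺)
open import Data.Nat using (ℕ; zero; suc; _+_; _*_; _∸_; _/_; _≤_; _≤?_; s≤s; s≤s⁻¹)
open import Data.Nat.DivMod using (m*n/n≡m; /-monoˡ-≤)
open import Data.Nat.Properties
  using ( ≤-trans; ≤-reflexive; <⇒≤; ≰⇒>; +-comm; *-comm; +-identityʳ; +-monoʳ-≤; +-monoˡ-≤
        ; ∸-monoˡ-≤; m≤n⇒m⊓n≡m; m∸[m∸n]≡n; m+n≤o⇒m≤o∸n; m+n≤o⇒m≤o; m+n≤o⇒n≤o
        ; module ≤-Reasoning )
open import Data.Product using (Σ; _×_; _,_; proj₁; proj₂)
open import Data.Sum using (_⊎_; inj₁; inj₂; [_,_]′)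
open import Function using (_∘_; id)
open import Relation.Binary.Definitions using (DecidableEquality)
open import Relation.Binary.PropositionalEquality
open import Relation.Nullary using (Dec; yes; no; ¬_; ¬?)
open import Relation.Nullary.Decidable using (⌊_⌋)

-- Lists without repetition

module _ {a} {A : Set a} where

  lookup-injective : ∀ {xs : List A} → Unique xs → ∀ {i j} → lookup xs i ≡ lookup xs j → i ≡ j
  lookup-injective (_ ∷ _)     {zero}  {zero}  _  = refl
  lookup-injective (x∉xs ∷ _)  {zero}  {suc j} eq = ⊥-elim (All.lookup x∉xs (∈-lookup j) eq)
  lookup-injective (x∉xs ∷ _)  {suc i} {zero}  eq = ⊥-elim (All.lookup x∉xs (∈-lookup i) (sym eq))
  lookup-injective (_ ∷ xs!)   {suc i} {suc j} eq = cong suc (lookup-injective xs! eq)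

  Unique-⊆⇒length≤ : ∀ {xs ys : List A} → Unique xs → xs ⊆ ys → length xs ≤ length ys
  Unique-⊆⇒length≤ xs! xs⊆ys = injective⇒≤ λ eq →
    lookup-injective xs! (index-injective (setoid A) (xs⊆ys (∈-lookup _)) (xs⊆ys (∈-lookup _)) eq)

  drop-⊆ : ∀ k (xs : List A) → drop k xs ⊆ xs
  drop-⊆ zero    xs       = id
  drop-⊆ (suc k) []       = id
  drop-⊆ (suc k) (x ∷ xs) = there ∘ drop-⊆ k xs

  take-++-⊆ : ∀ k (xs ys : List A) → k ≤ length xs → take k (xs ++ ys) ⊆ xs
  take-++-⊆ (suc k) (x ∷ xs) ys _         (here refl) = here refl
  take-++-⊆ (suc k) (x ∷ xs) ys (s≤s k≤n) (there w∈) = there (take-++-⊆ k xs ys k≤n w∈)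

  drop-++-⊆ : ∀ k (xs ys : List A) → length xs ≤ k → drop k (xs ++ ys) ⊆ ys
  drop-++-⊆ k       []       ys _         = drop-⊆ k ys
  drop-++-⊆ (suc k) (x ∷ xs) ys (s≤s n≤k) = drop-++-⊆ k xs ys n≤k

  take-drop-disjoint : ∀ {k j} (xs : List A) → k ≤ j → Unique xs → Disjoint (take k xs) (drop j xs)
  take-drop-disjoint (x ∷ xs) (s≤s {k} {j} _) (x∉xs ∷ _) (here refl , v∈drop) =
    All.lookup x∉xs (drop-⊆ j xs v∈drop) refl
  take-drop-disjoint (x ∷ xs) (s≤s k≤j) (_ ∷ xs!) (there v∈take , v∈drop) =
    take-drop-disjoint xs k≤j xs! (v∈take , v∈drop)

  record DisjointSelection (xs ys : List A) (p q : ℕ) : Set a where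
    field
      P Q   : List A
      P!    : Unique P
      Q!    : Unique Q
      P#Q   : Disjoint P Q
      P⊆xs  : P ⊆ xs
      Q⊆ys  : Q ⊆ ys
      p≤|P| : p ≤ length P
      q≤|Q| : q ≤ length Q

  DisjointSelection-mono : ∀ {xs xs′ ys ys′ p q} → xs ⊆ xs′ → ys ⊆ ys′ →
    DisjointSelection xs ys p q → DisjointSelection xs′ ys′ p q
  DisjointSelection-mono xs⊆xs′ ys⊆ys′ S = record
    { P = P ; Q = Q ; P! = P! ; Q! = Q! ; P#Q = P#Q
    ; P⊆xs = xs⊆xs′ ∘ P⊆xs ; Q⊆ys = ys⊆ys′ ∘ Q⊆ys
    ; p≤|P| = p≤|P| ; q≤|Q| = q≤|Q|
    }
    where open DisjointSelection S

  prefix-suffix-selection : ∀ {p q} (as bs cs : List A) → Unique (as ++ bs ++ cs) →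
    p ≤ length (as ++ bs) → q ≤ length (bs ++ cs) → p + q ≤ length (as ++ bs ++ cs) →
    DisjointSelection (as ++ bs) (bs ++ cs) p q
  prefix-suffix-selection {p} {q} as bs cs W! p≤|as++bs| q≤|bs++cs| p+q≤N = record
    { P     = take p W
    ; Q     = drop (N ∸ q) W
    ; P!    = take⁺ p W!
    ; Q!    = drop⁺ (N ∸ q) W!
    ; P#Q   = take-drop-disjoint W (m+n≤o⇒m≤o∸n p p+q≤N) W!
    ; P⊆xs  = subst (λ L → take p L ⊆ as ++ bs) (++-assoc as bs cs)
                (take-++-⊆ p (as ++ bs) cs p≤|as++bs|)
    ; Q⊆ys  = drop-++-⊆ (N ∸ q) as (bs ++ cs) |as|≤N∸q
    ; p≤|P| = ≤-reflexive (sym (trans (length-take p W) (m≤n⇒m⊓n≡m (m+n≤o⇒m≤o p p+q≤N))))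
    ; q≤|Q| = ≤-reflexive (sym (trans (length-drop (N ∸ q) W) (m∸[m∸n]≡n (m+n≤o⇒n≤o p p+q≤N))))
    }
    where
    W = as ++ bs ++ cs
    N = length W
    |as|≤N∸q : length as ≤ N ∸ q
    |as|≤N∸q = m+n≤o⇒m≤o∸n (length as)
      (≤-trans (+-monoʳ-≤ (length as) q≤|bs++cs|) (≤-reflexive (sym (length-++ as))))

module _ {a b} {A : Set a} {B : Set b} {xs : List A} {ys : List B}
         (ys! : Unique ys) (|xs|≤|ys| : length xs ≤ length ys) where

  slot : ∀ {x} → x ∈ xs → B
  slot x∈xs = lookup ys (inject≤ (index x∈xs) |xs|≤|ys|)

  slot-∈ : ∀ {x} (x∈xs : x ∈ xs) → slot x∈xs ∈ ys
  slot-∈ _ = ∈-lookup _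

  slot-injective : ∀ {x y} (x∈xs : x ∈ xs) (y∈xs : y ∈ xs) → slot x∈xs ≡ slot y∈xs → x ≡ y
  slot-injective x∈xs y∈xs =
    index-injective (setoid A) x∈xs y∈xs ∘ inject≤-injective _ _ _ _ ∘ lookup-injective ys!

module _ {a} {A : Set a} (_≟_ : DecidableEquality A) where
  open import Data.List.Membership.DecPropositional _≟_ using (_∈?_)

  _∖_ : List A → List A → List A
  xs ∖ ys = filter (λ w → ¬? (w ∈? ys)) xs

  _∩_ : List A → List A → List A
  xs ∩ ys = filter (_∈? ys) xs

  ∈-∖⁻ : ∀ {w} xs ys → w ∈ xs ∖ ys → w ∈ xs × w ∉ ys
  ∈-∖⁻ xs ys = ∈-filter⁻ (λ w → ¬? (w ∈? ys)) {xs = xs}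

  ∈-∩⁻ : ∀ {w} xs ys → w ∈ xs ∩ ys → w ∈ xs × w ∈ ys
  ∈-∩⁻ xs ys = ∈-filter⁻ (_∈? ys) {xs = xs}

  ∖-∩-⊆ : ∀ xs ys → (xs ∖ ys) ++ (xs ∩ ys) ⊆ xs
  ∖-∩-⊆ xs ys = [ proj₁ ∘ ∈-∖⁻ xs ys , proj₁ ∘ ∈-∩⁻ xs ys ]′ ∘ ∈-++⁻ (xs ∖ ys)

  ⊆-∖-∩ : ∀ xs ys → xs ⊆ (xs ∖ ys) ++ (xs ∩ ys)
  ⊆-∖-∩ xs ys {w} w∈xs with w ∈? ys
  ... | yes w∈ys = ∈-++⁺ʳ (xs ∖ ys) (∈-filter⁺ (_∈? ys) w∈xs w∈ys)
  ... | no  w∉ys = ∈-++⁺ˡ (∈-filter⁺ (λ w → ¬? (w ∈? ys)) w∈xs w∉ys)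

  disjointSelection : ∀ {p q} (xs ys zs : List A) → Unique xs → Unique ys → Unique zs →
    (∀ {w} → w ∈ zs → w ∈ xs ⊎ w ∈ ys) →
    p ≤ length xs → q ≤ length ys → p + q ≤ length zs → DisjointSelection xs ys p q
  disjointSelection xs ys zs xs! ys! zs! zs⊆xs∪ys p≤|xs| q≤|ys| p+q≤|zs| =
    DisjointSelection-mono (∖-∩-⊆ xs ys) ys-parts
      (prefix-suffix-selection (xs ∖ ys) (xs ∩ ys) (ys ∖ xs) W!
        (≤-trans p≤|xs| (Unique-⊆⇒length≤ xs! (⊆-∖-∩ xs ys)))
        (≤-trans q≤|ys| (Unique-⊆⇒length≤ ys! (⊆-parts ∘ ⊆-∖-∩ ys xs)))
        (≤-trans p+q≤|zs| (Unique-⊆⇒length≤ zs! zs⊆W)))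
    where
    ∩-swap : ∀ {w} → w ∈ ys ∩ xs → w ∈ xs ∩ ys
    ∩-swap w∈ = let (w∈ys , w∈xs) = ∈-∩⁻ ys xs w∈ in ∈-filter⁺ (_∈? ys) w∈xs w∈ys

    ⊆-parts : (ys ∖ xs) ++ (ys ∩ xs) ⊆ (xs ∩ ys) ++ (ys ∖ xs)
    ⊆-parts w∈ with ∈-++⁻ (ys ∖ xs) w∈
    ... | inj₁ w∈ys∖xs = ∈-++⁺ʳ (xs ∩ ys) w∈ys∖xs
    ... | inj₂ w∈ys∩xs = ∈-++⁺ˡ (∩-swap w∈ys∩xs)

    ys-parts : (xs ∩ ys) ++ (ys ∖ xs) ⊆ ys
    ys-parts = [ proj₂ ∘ ∈-∩⁻ xs ys , proj₁ ∘ ∈-∖⁻ ys xs ]′ ∘ ∈-++⁻ (xs ∩ ys)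

    W! : Unique ((xs ∖ ys) ++ (xs ∩ ys) ++ (ys ∖ xs))
    W! = ++⁺ (filter⁺ _ xs!) (++⁺ (filter⁺ _ xs!) (filter⁺ _ ys!) ∩#∖) ∖#rest
      where
      ∩#∖ : Disjoint (xs ∩ ys) (ys ∖ xs)
      ∩#∖ (w∈xs∩ys , w∈ys∖xs) = proj₂ (∈-∖⁻ ys xs w∈ys∖xs) (proj₁ (∈-∩⁻ xs ys w∈xs∩ys))
      ∖#rest : Disjoint (xs ∖ ys) ((xs ∩ ys) ++ (ys ∖ xs))
      ∖#rest (w∈xs∖ys , w∈ys) = proj₂ (∈-∖⁻ xs ys w∈xs∖ys) (ys-parts w∈ys)

    zs⊆W : zs ⊆ (xs ∖ ys) ++ (xs ∩ ys) ++ (ys ∖ xs)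
    zs⊆W w∈zs with zs⊆xs∪ys w∈zs
    ... | inj₂ w∈ys = ∈-++⁺ʳ (xs ∖ ys) (⊆-parts (⊆-∖-∩ ys xs w∈ys))
    ... | inj₁ w∈xs with ∈-++⁻ (xs ∖ ys) (⊆-∖-∩ xs ys w∈xs)
    ...   | inj₁ w∈xs∖ys = ∈-++⁺ˡ w∈xs∖ys
    ...   | inj₂ w∈xs∩ys = ∈-++⁺ʳ (xs ∖ ys) (∈-++⁺ˡ w∈xs∩ys)

-- Vertex lists of a graph

⌊⌋≡true⁺ : ∀ {A : Set} (a? : Dec A) → A → ⌊ a? ⌋ ≡ true
⌊⌋≡true⁺ (yes _) _ = refl
⌊⌋≡true⁺ (no ¬a) a = ⊥-elim (¬a a)

⌊⌋≡true⁻ : ∀ {A : Set} (a? : Dec A) → ⌊ a? ⌋ ≡ true → A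
⌊⌋≡true⁻ (yes a) _ = a

-- countV p is length (vertices p) by definition, hence so are deg, nbrMinus and unionNbrMinus.
vertices : ∀ {n} → (Fin n → Bool) → List (Fin n)
vertices {n} p = filter (λ w → p w Bool.≟ true) (allFin n)

module _ {n} {p : Fin n → Bool} where

  ∈-vertices⁺ : ∀ {w} → p w ≡ true → w ∈ vertices p
  ∈-vertices⁺ {w} = ∈-filter⁺ (λ w → p w Bool.≟ true) (∈-allFin w)

  ∈-vertices⁻ : ∀ {w} → w ∈ vertices p → p w ≡ true
  ∈-vertices⁻ = proj₂ ∘ ∈-filter⁻ (λ w → p w Bool.≟ true) {xs = allFin n}

  vertices-unique : Unique (vertices p)
  vertices-unique = filter⁺ (λ w → p w Bool.≟ true) (allFin⁺ n)

exactly-two : ∀ {n} (p : Fin n → Bool) → length (vertices p) ≡ 2 →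
  Σ (Fin n) λ x → Σ (Fin n) λ y → x ≢ y × p x ≡ true × p y ≡ true ×
    (∀ {z} → p z ≡ true → z ≡ x ⊎ z ≡ y)
exactly-two p |p|≡2 with vertices p | |p|≡2 | vertices-unique {p = p}
                       | (λ {z} → ∈-vertices⁺ {p = p} {z}) | (λ {z} → ∈-vertices⁻ {p = p} {z})
... | x ∷ y ∷ [] | refl | (x≢y ∷ []) ∷ _ | ∈⁺ | ∈⁻ =
  x , y , x≢y , ∈⁻ (here refl) , ∈⁻ (there (here refl)) , λ pz → case (∈⁺ pz)
  where
  case : ∀ {z} → z ∈ x ∷ y ∷ [] → z ≡ x ⊎ z ≡ y
  case (here z≡x) = inj₁ z≡x
  case (there (here z≡y)) = inj₂ z≡y

module _ {n} (G : Graph n) where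

  nbrs : Fin n → List (Fin n)
  nbrs c = vertices (adj G c)

  nbrsExcept : Fin n → Fin n → List (Fin n)
  nbrsExcept c d = vertices (λ w → adj G c w ∧ not ⌊ w ≟ d ⌋)

  adj-sym : ∀ {a b} → adj G a b ≡ true → adj G b a ≡ true
  adj-sym {a} {b} = trans (Graph.sym G b a)

  adj⇒≢ : ∀ {a b} → adj G a b ≡ true → a ≢ b
  adj⇒≢ {a} ab refl with trans (sym ab) (irrefl G a)
  ... | ()

  ∈-nbrsExcept⁺ : ∀ {c d w} → adj G c w ≡ true → w ≢ d → w ∈ nbrsExcept c d
  ∈-nbrsExcept⁺ {d = d} {w} cw w≢d = ∈-vertices⁺ (true-∧-not (w ≟ d) cw w≢d)
    where
    true-∧-not : ∀ {b} {A : Set} (a? : Dec A) → b ≡ true → ¬ A → b ∧ not ⌊ a? ⌋ ≡ true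
    true-∧-not (yes a) _    ¬a = ⊥-elim (¬a a)
    true-∧-not (no _)  refl _  = refl

  ∈-nbrsExcept⁻ : ∀ {c d w} → w ∈ nbrsExcept c d → adj G c w ≡ true × w ≢ d
  ∈-nbrsExcept⁻ {c} {d} {w} w∈ with adj G c w | w ≟ d | ∈-vertices⁻ w∈
  ... | true | no w≢d | _ = refl , w≢d

  ∈-unionNbrs⁻ : ∀ {u v w} →
    w ∈ vertices (λ w → (adj G u w ∨ adj G v w) ∧ not ⌊ w ≟ u ⌋ ∧ not ⌊ w ≟ v ⌋) →
    w ∈ nbrsExcept u v ⊎ w ∈ nbrsExcept v u
  ∈-unionNbrs⁻ {u} {v} {w} w∈
    with adj G u w in uw | adj G v w in vw | w ≟ u | w ≟ v | ∈-vertices⁻ w∈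
  ... | true  | _    | no w≢u | no w≢v | _ = inj₁ (∈-nbrsExcept⁺ uw w≢v)
  ... | false | true | no w≢u | no w≢v | _ = inj₂ (∈-nbrsExcept⁺ vw w≢u)

  deg≤1+nbrMinus : ∀ c d → deg G c ≤ suc (nbrMinus G c d)
  deg≤1+nbrMinus c d = Unique-⊆⇒length≤ vertices-unique split
    where
    split : nbrs c ⊆ d ∷ nbrsExcept c d
    split {w} w∈ with w ≟ d
    ... | yes refl = here refl
    ... | no w≢d = there (∈-nbrsExcept⁺ (∈-vertices⁻ w∈) w≢d)

  two-nbrs⇒2≤deg : ∀ {c a b} → adj G c a ≡ true → adj G c b ≡ true → a ≢ b → 2 ≤ deg G c
  two-nbrs⇒2≤deg ca cb a≢b = Unique-⊆⇒length≤ ((a≢b ∷ []) ∷ [] ∷ []) λ where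
    (here refl) → ∈-vertices⁺ ca
    (there (here refl)) → ∈-vertices⁺ cb

  Walk-closed : (S : Fin n → Set) → (∀ {a b} → S a → adj G a b ≡ true → S b) →
    ∀ {a b} → S a → Walk G a b → S b
  Walk-closed S closed Sa here = Sa
  Walk-closed S closed Sa (step ab walk) = Walk-closed S closed (closed Sa ab) walk

-- Structure of a double star

UnbranchedOutside : ∀ {m} → Graph m → Fin m → Fin m → Set
UnbranchedOutside T x y = ∀ {z a b} → z ≢ x → z ≢ y → adj T z a ≡ true → adj T z b ≡ true → a ≡ b

module _ {m} {T : Graph m} (connected : Connected T) {x y : Fin m} (x≢y : x ≢ y)
         (leaf-nbrs-equal : UnbranchedOutside T x y) where

  -- Otherwise x and its neighbours would form a component avoiding y.
  connected⇒centres-adjacent : adj T x y ≡ true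
  connected⇒centres-adjacent with adj T x y in xy
  ... | true  = refl
  ... | false with Walk-closed T S closed (inj₁ refl) (connected x y)
    where
    S : Fin m → Set
    S w = w ≡ x ⊎ adj T x w ≡ true
    closed : ∀ {a b} → S a → adj T a b ≡ true → S b
    closed (inj₁ refl) xb = inj₂ xb
    closed {a} (inj₂ xa) ab = inj₁ (leaf-nbrs-equal (adj⇒≢ T xa ∘ sym) a≢y ab (adj-sym T xa))
      where
      a≢y : a ≢ y
      a≢y refl with trans (sym xa) xy
      ... | ()
  ...   | inj₁ y≡x = ⊥-elim (x≢y (sym y≡x))
  ...   | inj₂ xy′ with trans (sym xy′) xy
  ...     | ()

  -- Otherwise z and its only neighbour would form a component avoiding x.
  connected⇒near-centres : ∀ z → z ≡ x ⊎ z ≡ y ⊎ adj T x z ≡ true ⊎ adj T y z ≡ true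
  connected⇒near-centres z with z ≟ x | z ≟ y | adj T x z in xz | adj T y z in yz
  ... | yes z≡x | _       | _     | _     = inj₁ z≡x
  ... | no _    | yes z≡y | _     | _     = inj₂ (inj₁ z≡y)
  ... | no _    | no _    | true  | _     = inj₂ (inj₂ (inj₁ refl))
  ... | no _    | no _    | false | true  = inj₂ (inj₂ (inj₂ refl))
  ... | no z≢x  | no z≢y  | false | false with connected z x
  ...   | here = ⊥-elim (z≢x refl)
  ...   | step {y = w} zw walk = ⊥-elim ([ (λ x≡z → z≢x (sym x≡z)) , (λ x≡w → w≢x (sym x≡w)) ]′
                                   (Walk-closed T S closed (inj₂ refl) walk))
    where
    w≢x : w ≢ x
    w≢x refl with trans (sym (adj-sym T zw)) xz
    ... | ()
    w≢y : w ≢ y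
    w≢y refl with trans (sym (adj-sym T zw)) yz
    ... | ()
    S : Fin m → Set
    S a = a ≡ z ⊎ a ≡ w
    closed : ∀ {a b} → S a → adj T a b ≡ true → S b
    closed (inj₁ refl) zb = inj₂ (leaf-nbrs-equal z≢x z≢y zb zw)
    closed (inj₂ refl) wb = inj₁ (leaf-nbrs-equal w≢x w≢y wb (adj-sym T zw))

record DoubleStarCentres {m} (T : Graph m) (x y : Fin m) : Set where
  field
    centres-adjacent : adj T x y ≡ true
    near-centres     : ∀ z → z ≡ x ⊎ z ≡ y ⊎ adj T x z ≡ true ⊎ adj T y z ≡ true
    leaf-nbrs-equal  : UnbranchedOutside T x y
    x-has-leaf       : 1 ≤ nbrMinus T x y
    y-has-leaf       : 1 ≤ nbrMinus T y x

doubleStarCentres : ∀ {m} {T : Graph m} → IsDoubleStar T →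
  Σ (Fin m) λ x → Σ (Fin m) λ y → DoubleStarCentres T x y
doubleStarCentres {T = T} ((connected , _) , two-branch-vertices)
  with exactly-two (λ z → ⌊ 2 ≤? deg T z ⌋) two-branch-vertices
... | x , y , x≢y , branch-x , branch-y , only-x-y = x , y , record
  { centres-adjacent = connected⇒centres-adjacent connected x≢y leaf-nbrs-equal
  ; near-centres     = connected⇒near-centres connected x≢y leaf-nbrs-equal
  ; leaf-nbrs-equal  = leaf-nbrs-equal
  ; x-has-leaf       = has-leaf branch-x
  ; y-has-leaf       = has-leaf branch-y
  }
  where
  leaf-nbrs-equal : UnbranchedOutside T x y
  leaf-nbrs-equal {z} {a} {b} z≢x z≢y za zb with a ≟ b
  ... | yes a≡b = a≡b
  ... | no  a≢b = ⊥-elim ([ z≢x , z≢y ]′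
                    (only-x-y (⌊⌋≡true⁺ (2 ≤? deg T z) (two-nbrs⇒2≤deg T za zb a≢b))))

  has-leaf : ∀ {c d} → ⌊ 2 ≤? deg T c ⌋ ≡ true → 1 ≤ nbrMinus T c d
  has-leaf {c} {d} branch = s≤s⁻¹ (≤-trans (⌊⌋≡true⁻ (2 ≤? deg T c) branch) (deg≤1+nbrMinus T c d))

module _ {m} {T : Graph m} {x y : Fin m} where

  swap : DoubleStarCentres T x y → DoubleStarCentres T y x
  swap D = record
    { centres-adjacent = adj-sym T centres-adjacent
    ; near-centres     = reorder ∘ near-centres
    ; leaf-nbrs-equal  = λ z≢y z≢x → leaf-nbrs-equal z≢x z≢y
    ; x-has-leaf       = y-has-leaf
    ; y-has-leaf       = x-has-leaf
    }
    where
    open DoubleStarCentres D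
    reorder : ∀ {A B C E : Set} → A ⊎ B ⊎ C ⊎ E → B ⊎ A ⊎ E ⊎ C
    reorder (inj₁ a)               = inj₂ (inj₁ a)
    reorder (inj₂ (inj₁ b))        = inj₁ b
    reorder (inj₂ (inj₂ (inj₁ c))) = inj₂ (inj₂ (inj₂ c))
    reorder (inj₂ (inj₂ (inj₂ e))) = inj₂ (inj₂ (inj₁ e))

leaf≢centres : ∀ {m} (T : Graph m) {x y z} → z ∈ nbrsExcept T x y → z ≢ x × z ≢ y
leaf≢centres T z∈ = let (xz , z≢y) = ∈-nbrsExcept⁻ T z∈ in adj⇒≢ T xz ∘ sym , z≢y

leaf-nbr≡centre : ∀ {m} {T : Graph m} {x y z w} → DoubleStarCentres T x y →
  z ∈ nbrsExcept T x y → adj T z w ≡ true → w ≡ x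
leaf-nbr≡centre {T = T} D z∈ zw = let (z≢x , z≢y) = leaf≢centres T z∈ in
  DoubleStarCentres.leaf-nbrs-equal D z≢x z≢y zw (adj-sym T (proj₁ (∈-nbrsExcept⁻ T z∈)))

module _ {m} {T : Graph m} {x y : Fin m} (D : DoubleStarCentres T x y) where
  open DoubleStarCentres D

  x≢y : x ≢ y
  x≢y = adj⇒≢ T centres-adjacent

  data Role (z : Fin m) : Set where
    centreˣ : z ≡ x → Role z
    centreʸ : z ≡ y → Role z
    leafˣ   : z ∈ nbrsExcept T x y → Role z
    leafʸ   : z ∈ nbrsExcept T y x → Role z

  role : ∀ z → Role z
  role z with near-centres z
  ... | inj₁ z≡x        = centreˣ z≡x
  ... | inj₂ (inj₁ z≡y) = centreʸ z≡y
  ... | inj₂ (inj₂ (inj₁ xz)) with z ≟ y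
  ...   | yes z≡y = centreʸ z≡y
  ...   | no  z≢y = leafˣ (∈-nbrsExcept⁺ T xz z≢y)
  role z | inj₂ (inj₂ (inj₂ yz)) with z ≟ x
  ...   | yes z≡x = centreˣ z≡x
  ...   | no  z≢x = leafʸ (∈-nbrsExcept⁺ T yz z≢x)

  order-bound : 2 + (nbrMinus T x y + nbrMinus T y x) ≤ m
  order-bound = begin
    2 + (nbrMinus T x y + nbrMinus T y x)
      ≡⟨ cong (2 +_) (length-++ (nbrsExcept T x y)) ⟨
    length (x ∷ y ∷ nbrsExcept T x y ++ nbrsExcept T y x)
      ≤⟨ Unique-⊆⇒length≤ centres-and-leaves-unique (λ {w} _ → ∈-allFin w) ⟩
    length (allFin m)
      ≡⟨ length-tabulate _ ⟩
    m ∎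
    where
    open ≤-Reasoning
    leaves≢centres : ∀ {z} → z ∈ nbrsExcept T x y ++ nbrsExcept T y x → x ≢ z × y ≢ z
    leaves≢centres z∈ with ∈-++⁻ (nbrsExcept T x y) z∈
    ... | inj₁ z∈Lx = let (z≢x , z≢y) = leaf≢centres T z∈Lx in z≢x ∘ sym , z≢y ∘ sym
    ... | inj₂ z∈Ly = let (z≢y , z≢x) = leaf≢centres T z∈Ly in z≢x ∘ sym , z≢y ∘ sym
    Lx#Ly : Disjoint (nbrsExcept T x y) (nbrsExcept T y x)
    Lx#Ly (z∈Lx , z∈Ly) = x≢y (sym (leaf-nbr≡centre D z∈Lx (adj-sym T (proj₁ (∈-nbrsExcept⁻ T z∈Ly)))))
    centres-and-leaves-unique : Unique (x ∷ y ∷ nbrsExcept T x y ++ nbrsExcept T y x)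
    centres-and-leaves-unique =
        (x≢y ∷ All.tabulate (proj₁ ∘ leaves≢centres))
      ∷ All.tabulate (proj₂ ∘ leaves≢centres)
      ∷ ++⁺ vertices-unique vertices-unique Lx#Ly

-- Embedding a double star

module _ {m n} {T : Graph m} (G : Graph n) {x y : Fin m} {u v : Fin n}
         (D : DoubleStarCentres T x y) (uv : adj G u v ≡ true)
         (S : DisjointSelection (nbrsExcept G u v) (nbrsExcept G v u) (nbrMinus T x y) (nbrMinus T y x))
         where
  open DisjointSelection S

  image : ∀ {z} → Role D z → Fin n
  image (centreˣ _) = u
  image (centreʸ _) = v
  image (leafˣ z∈)  = slot P! p≤|P| z∈
  image (leafʸ z∈)  = slot Q! q≤|Q| z∈

  image-leafˣ∈P : ∀ {z} (z∈ : z ∈ nbrsExcept T x y) → image (leafˣ z∈) ∈ P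
  image-leafˣ∈P = slot-∈ P! p≤|P|

  image-leafʸ∈Q : ∀ {z} (z∈ : z ∈ nbrsExcept T y x) → image (leafʸ z∈) ∈ Q
  image-leafʸ∈Q = slot-∈ Q! q≤|Q|

  image-leafˣ : ∀ {z} (z∈ : z ∈ nbrsExcept T x y) →
    adj G u (image (leafˣ z∈)) ≡ true × image (leafˣ z∈) ≢ v
  image-leafˣ = ∈-nbrsExcept⁻ G ∘ P⊆xs ∘ image-leafˣ∈P

  image-leafʸ : ∀ {z} (z∈ : z ∈ nbrsExcept T y x) →
    adj G v (image (leafʸ z∈)) ≡ true × image (leafʸ z∈) ≢ u
  image-leafʸ = ∈-nbrsExcept⁻ G ∘ Q⊆ys ∘ image-leafʸ∈Q

  u≢v : u ≢ v
  u≢v = adj⇒≢ G uv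

  leafˣ-nbr≡x : ∀ {z w} → z ∈ nbrsExcept T x y → adj T z w ≡ true → w ≡ x
  leafˣ-nbr≡x = leaf-nbr≡centre D

  leafʸ-nbr≡y : ∀ {z w} → z ∈ nbrsExcept T y x → adj T z w ≡ true → w ≡ y
  leafʸ-nbr≡y = leaf-nbr≡centre (swap D)

  image-injective : ∀ {a b} (r : Role D a) (s : Role D b) → image r ≡ image s → a ≡ b
  image-injective (centreˣ refl) (centreˣ refl) _ = refl
  image-injective (centreʸ refl) (centreʸ refl) _ = refl
  image-injective (centreˣ _)    (centreʸ _)    e = ⊥-elim (u≢v e)
  image-injective (centreʸ _)    (centreˣ _)    e = ⊥-elim (u≢v (sym e))
  image-injective (centreˣ _)    (leafˣ b∈)     e = ⊥-elim (adj⇒≢ G (proj₁ (image-leafˣ b∈)) e)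
  image-injective (leafˣ a∈)     (centreˣ _)    e = ⊥-elim (adj⇒≢ G (proj₁ (image-leafˣ a∈)) (sym e))
  image-injective (centreʸ _)    (leafʸ b∈)     e = ⊥-elim (adj⇒≢ G (proj₁ (image-leafʸ b∈)) e)
  image-injective (leafʸ a∈)     (centreʸ _)    e = ⊥-elim (adj⇒≢ G (proj₁ (image-leafʸ a∈)) (sym e))
  image-injective (centreˣ _)    (leafʸ b∈)     e = ⊥-elim (proj₂ (image-leafʸ b∈) (sym e))
  image-injective (leafʸ a∈)     (centreˣ _)    e = ⊥-elim (proj₂ (image-leafʸ a∈) e)
  image-injective (centreʸ _)    (leafˣ b∈)     e = ⊥-elim (proj₂ (image-leafˣ b∈) (sym e))
  image-injective (leafˣ a∈)     (centreʸ _)    e = ⊥-elim (proj₂ (image-leafˣ a∈) e)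
  image-injective (leafˣ a∈)     (leafˣ b∈)     e = slot-injective P! p≤|P| a∈ b∈ e
  image-injective (leafʸ a∈)     (leafʸ b∈)     e = slot-injective Q! q≤|Q| a∈ b∈ e
  image-injective (leafˣ a∈)     (leafʸ b∈)     e =
    ⊥-elim (P#Q (image-leafˣ∈P a∈ , subst (_∈ Q) (sym e) (image-leafʸ∈Q b∈)))
  image-injective (leafʸ a∈)     (leafˣ b∈)     e =
    ⊥-elim (P#Q (subst (_∈ P) (sym e) (image-leafˣ∈P b∈) , image-leafʸ∈Q a∈))

  image-adj : ∀ {a b} (r : Role D a) (s : Role D b) →
    adj T a b ≡ true → adj G (image r) (image s) ≡ true
  image-adj (centreˣ refl) (centreʸ refl) _ = uv
  image-adj (centreʸ refl) (centreˣ refl) _ = adj-sym G uv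
  image-adj (centreˣ refl) (leafˣ b∈)     _ = proj₁ (image-leafˣ b∈)
  image-adj (leafˣ a∈)     (centreˣ refl) _ = adj-sym G (proj₁ (image-leafˣ a∈))
  image-adj (centreʸ refl) (leafʸ b∈)     _ = proj₁ (image-leafʸ b∈)
  image-adj (leafʸ a∈)     (centreʸ refl) _ = adj-sym G (proj₁ (image-leafʸ a∈))
  image-adj (centreˣ refl) (centreˣ refl) ab = ⊥-elim (adj⇒≢ T ab refl)
  image-adj (centreʸ refl) (centreʸ refl) ab = ⊥-elim (adj⇒≢ T ab refl)
  image-adj (centreˣ refl) (leafʸ b∈)     ab = ⊥-elim (x≢y D (leafʸ-nbr≡y b∈ (adj-sym T ab)))
  image-adj (leafʸ a∈)     (centreˣ refl) ab = ⊥-elim (x≢y D (leafʸ-nbr≡y a∈ ab))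
  image-adj (centreʸ refl) (leafˣ b∈)     ab = ⊥-elim (x≢y D (sym (leafˣ-nbr≡x b∈ (adj-sym T ab))))
  image-adj (leafˣ a∈)     (centreʸ refl) ab = ⊥-elim (x≢y D (sym (leafˣ-nbr≡x a∈ ab)))
  image-adj (leafˣ a∈)     (leafˣ b∈)     ab = ⊥-elim (proj₁ (leaf≢centres T b∈) (leafˣ-nbr≡x a∈ ab))
  image-adj (leafˣ a∈)     (leafʸ b∈)     ab = ⊥-elim (proj₂ (leaf≢centres T b∈) (leafˣ-nbr≡x a∈ ab))
  image-adj (leafʸ a∈)     (leafˣ b∈)     ab = ⊥-elim (proj₂ (leaf≢centres T b∈) (leafʸ-nbr≡y a∈ ab))
  image-adj (leafʸ a∈)     (leafʸ b∈)     ab = ⊥-elim (proj₁ (leaf≢centres T b∈) (leafʸ-nbr≡y a∈ ab))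

  double-star-copy : ContainsCopy G T
  double-star-copy = image ∘ role D , (λ {a} {b} → image-injective (role D a) (role D b)) ,
                     λ a b → image-adj (role D a) (role D b)

double-star-bounds : ∀ {p q m} → 1 ≤ p → p ≤ q → 2 + (p + q) ≤ m →
  p ≤ m / 2 ∸ 1 × q ≤ m ∸ 3 × p + q ≤ m ∸ 2
double-star-bounds {p} {q} {m} 1≤p p≤q order =
  ∸-monoˡ-≤ 1 1+p≤m/2 ,
  m+n≤o⇒m≤o∸n q (begin
    q + 3       ≡⟨ +-comm q 3 ⟩
    2 + (1 + q) ≤⟨ +-monoʳ-≤ 2 (+-monoˡ-≤ q 1≤p) ⟩
    2 + (p + q) ≤⟨ order ⟩
    m           ∎) ,
  m+n≤o⇒m≤o∸n (p + q) (≤-trans (≤-reflexive (+-comm (p + q) 2)) order)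
  where
  open ≤-Reasoning
  1+p≤m/2 : suc p ≤ m / 2
  1+p≤m/2 = begin
    suc p           ≡⟨ m*n/n≡m (suc p) 2 ⟨
    suc p * 2 / 2   ≤⟨ /-monoˡ-≤ 2 (begin
      suc p * 2       ≡⟨ [1+p]*2≡2+[p+p] ⟩
      2 + (p + p)     ≤⟨ +-monoʳ-≤ 2 (+-monoʳ-≤ p p≤q) ⟩
      2 + (p + q)     ≤⟨ order ⟩
      m               ∎) ⟩
    m / 2           ∎
    where
    [1+p]*2≡2+[p+p] : suc p * 2 ≡ 2 + (p + p)
    [1+p]*2≡2+[p+p] = cong (2 +_) (trans (*-comm p 2) (cong (p +_) (+-identityʳ p)))

copy-via-centres : ∀ {n m} (G : Graph n) {T : Graph m} {x y u v} →
  DoubleStarCentres T x y → nbrMinus T x y ≤ nbrMinus T y x → adj G u v ≡ true →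
  (m / 2) ∸ 1 ≤ nbrMinus G u v → m ∸ 3 ≤ nbrMinus G v u → m ∸ 2 ≤ unionNbrMinus G u v →
  ContainsCopy G T
copy-via-centres G {u = u} {v} D p≤q uv p-room q-room union-room
  with p≤ , q≤ , p+q≤ ← double-star-bounds (DoubleStarCentres.x-has-leaf D) p≤q (order-bound D) =
  double-star-copy G D uv (disjointSelection _≟_ (nbrsExcept G u v) (nbrsExcept G v u) _
    vertices-unique vertices-unique vertices-unique (∈-unionNbrs⁻ G)
    (≤-trans p≤ p-room) (≤-trans q≤ q-room) (≤-trans p+q≤ union-room))

lemma3p1 : {n m : ℕ} (G : Graph n) (T : Graph m) → IsDoubleStar T →
    Σ (Fin n) (λ u → Σ (Fin n) (λ v → adj G u v ≡ true ×
      (m / 2) ∸ 1 ≤ nbrMinus G u v × m ∸ 3 ≤ nbrMinus G v u ×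
      m ∸ 2 ≤ unionNbrMinus G u v)) →
    ContainsCopy G T
lemma3p1 G T double-star (u , v , uv , p-room , q-room , union-room)
  with x , y , D ← doubleStarCentres double-star
  with nbrMinus T x y ≤? nbrMinus T y x
... | yes p≤q = copy-via-centres G D        p≤q               uv p-room q-room union-room
... | no  p≰q = copy-via-centres G (swap D) (<⇒≤ (≰⇒> p≰q)) uv p-room q-room union-room
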